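{- Let $k\ge3$ be an odd integer, and let $A$ be a cyclically $k$-diagonal array of size $n>k$ in standard form. Let $R=(1,\dots,1)$, and let $C\in\{ -1,1\}^n$ have its entries $-1$ exactly in the positions of the list $E$. Then $R$ and $C$ are a solution of $P(A)$ if and only if both of the following hold: 1) with $d=\gcd(n,k-1)$, the list $E$ covers all congruence classes modulo $d$; 2) the list $L(1,1)$ contains all the cells $(e,e)$ with $e\in E$.
   Context: Arrays are toroidal: an $n\times n$ array has rows and columns indexed modulo $n$ (representatives $1,\dots,n$). Each cell is filled or empty; $F(A)$ is the set of filled cells. For $(i,j)\in F(A)$: - the row successor $s_r((i,j))$ is $(i,j+k)$ with $k\ge1$ minimal such that $(i,j+k)\in F(A)$; - the column successor $s_c((i,j))$ is $(i+k,j)$ with $k\ge1$ minimal such that $(i+k,j)\in F(A)$. Given $R,C\in\{ -1,1\}^n$, the move function is $S_{R,C}((i,j))=s_c^{\,c_{j'}}((i,j'))$, where $(i,j')=s_r^{\,r_i}((i,j))$; exponent $-1$ means inverse. For filled $(i,j)$, $L(i,j)=((i,j),S_{R,C}((i,j)),\dots,S_{R,C}^p((i,j)))$, where $p\ge0$ is minimal with $S_{R,C}^{p+1}((i,j))=(i,j)$. $R,C$ is a solution of $P(A)$ if $L(1,1)$ covers $F(A)$. Diagonals: $D_i=\{(i+t-1,t):t=1,\dots,n\}$, with row indices modulo $n$. A square array of size $n>k$ is cyclically $k$-diagonal if its filled cells are exactly those of $k$ diagonals consecutive modulo $n$. It is in standard form if the filled diagonals are $D_1,\dots,D_k$. "$E$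 covers all congruence classes modulo $d$" means every residue modulo $d$ is congruent to some element of $E$. -}

module Defs where

open import Data.Nat using (ℕ; zero; suc; _+_; _*_; _∸_; _<_; _≤_; NonZero; ∣_-_∣)
open import Data.Nat.DivMod using (_%_; m%n<n)
open import Data.Nat.Divisibility using (_∣_)
open import Data.Fin using (Fin; toℕ; fromℕ<; zero) renaming (_≟_ to _≟ᶠ_)
open import Data.Bool using (Bool; true; false; if_then_else_)
open import Data.Product using (_×_; _,_; proj₁; proj₂; ∃; Σ)
open import Data.Product.Properties using (≡-dec)
open import Data.List using (List; []; _∷_; takeWhile)
open import Data.List.Membership.Propositional using (_∈_)
open import Data.List.Relation.Unary.Any using (Any)
open import Data.Sign using (Sign) renaming (+ to pos; - to neg)
open import Relation.Nullary using (¬?; does)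
open import Relation.Binary.PropositionalEquality using (_≡_)
open import Function.Bundles using (_⇔_)

-- Indices are 0-based: paper index i ∈ {1..n} corresponds to Fin n element i-1.
Cell : ℕ → Set
Cell n = Fin n × Fin n

row col : ∀ {n} → Cell n → Fin n
row = proj₁
col = proj₂

_≟c_ : ∀ {n} (a b : Cell n) → Relation.Nullary.Dec (a ≡ b)
_≟c_ = ≡-dec _≟ᶠ_ _≟ᶠ_

Array : ℕ → Set
Array n = Cell n → Bool

shift : ∀ {n} .{{_ : NonZero n}} → Fin n → ℕ → Fin n
shift {n} i m = fromℕ< (m%n<n (toℕ i + m) n)

origin : ∀ {n} .{{_ : NonZero n}} → Fin n
origin {n} = fromℕ< (m%n<n 0 n)

-- least k in {start, start+1, ..., start+fuel-1} with p k (default: start+fuel)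
findFrom : (ℕ → Bool) → ℕ → ℕ → ℕ
findFrom p zero    k = k
findFrom p (suc f) k = if p k then k else findFrom p f (suc k)

module _ {n : ℕ} .{{_ : NonZero n}} (A : Array n) where

  sr : Cell n → Cell n
  sr (i , j) = i , shift j (findFrom (λ k → A (i , shift j k)) n 1)

  -- inverse of the row successor (on filled cells): (i, j-k), k ≥ 1 minimal
  sr⁻¹ : Cell n → Cell n
  sr⁻¹ (i , j) = i , shift j (n ∸ findFrom (λ k → A (i , shift j (n ∸ k))) n 1)

  sc : Cell n → Cell n
  sc (i , j) = shift i (findFrom (λ k → A (shift i k , j)) n 1) , j

  -- inverse of the column successor (on filled cells)
  sc⁻¹ : Cell n → Cell n
  sc⁻¹ (i , j) = shift i (n ∸ findFrom (λ k → A (shift i (n ∸ k) , j)) n 1) , j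

  rowStep : Sign → Cell n → Cell n
  rowStep pos = sr
  rowStep neg = sr⁻¹

  colStep : Sign → Cell n → Cell n
  colStep pos = sc
  colStep neg = sc⁻¹

  S : (R C : Fin n → Sign) → Cell n → Cell n
  S R C c = colStep (C (col c')) c'
    where c' = rowStep (R (row c)) c

  iterates : (R C : Fin n → Sign) → ℕ → Cell n → List (Cell n)
  iterates R C zero    c = []
  iterates R C (suc m) c = c ∷ iterates R C m (S R C c)

  -- L(c) = (c, S c, ..., S^p c) with p minimal such that S^(p+1) c = c.
  -- (Since S permutes the at most n*n filled cells, p+1 ≤ n*n.)
  L : (R C : Fin n → Sign) → Cell n → List (Cell n)
  L R C c = c ∷ takeWhile (λ x → ¬? (x ≟c c)) (iterates R C (n * n) (S R C c))

  F : Cell n → Set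
  F c = A c ≡ true

  IsSolution : (R C : Fin n → Sign) → Set
  IsSolution R C = ∀ c → F c → c ∈ L R C (origin , origin)

-- Diagonal D_i (paper index i ≥ 1): cells (i+t-1, t), t = 1..n, rows mod n.
-- In 0-based indices: cell (r, c) with r = c + (i-1) mod n.
InDiag : ∀ {n} .{{_ : NonZero n}} → ℕ → Cell n → Set
InDiag i (r , c) = r ≡ shift c (i ∸ 1)

StandardForm : ∀ {n} .{{_ : NonZero n}} → ℕ → Array n → Set
StandardForm {n} k A = ∀ c → (A c ≡ true) ⇔ (Σ ℕ λ i → (1 ≤ i) × (i ≤ k) × InDiag i c)

CoversResidues : ∀ {n} → ℕ → List (Fin n) → Set
CoversResidues d E = ∀ (x : ℕ) → Any (λ e → d ∣ ∣ toℕ e - x ∣) E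

module Submission where

-- Address the filled cell (j + δ, j) by its column j and its offset δ < k.  A move
-- from offset 0 goes to column j + (n - k + 1), from offset δ > 0 to column j + 1,
-- and it keeps the offset unless the new column is negative, in which case the
-- offset drops by 2 modulo k.
-- (⇒) If the columns of some class modulo d are all positive, the diagonal cells of
-- that class are closed under the move and its inverse (d divides n - k + 1); as
-- L(1,1) contains one of them, the orbit of (1,1) never leaves offset 0.
-- (⇐) A positive column x passes the orbit from (x + k - 1, x + k - 1) to (x, x);
-- by Bézout some x + m(k - 1) lies in E, so every diagonal cell is reached.  The
-- reached offsets are closed under δ ↦ δ - 2 (mod k), which generates ℤ/k for odd k.
-- As the move is injective on filled cells, L(1,1) is the whole orbit of (1,1).

open import Defs
open import Data.Nat using (ℕ; zero; suc; _+_; _*_; _∸_; _<_; _≤_; NonZero; z≤n; s≤s; ∣_-_∣; ≢-nonZero; ≢-nonZero⁻¹)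
open import Data.Nat.Properties
open import Data.Nat.DivMod using (_%_; _/_; m%n<n; m∣n⇒o%n%m≡o%m; m≡m%n+[m/n]*n; m<n⇒m%n≡m; [m+kn]%n≡m%n; [m+n]%n≡m%n; %-distribˡ-+; m%n%n≡m%n; %-remove-+ʳ)
open import Data.Nat.Divisibility using (_∣_; _∣?_; divides; ∣n⇒∣m*n; ∣m+n∣m⇒∣n; 0∣⇒≡0; ∣⇒≤; 1∣_)
open import Data.Nat.GCD using (gcd; gcd[m,n]∣m; gcd[m,n]∣n; gcd[m,n]≢0; gcd-GCD; module Bézout)
open import Data.Nat.GeneralisedArithmetic using (iterate)
open import Data.Fin using (Fin; toℕ; fromℕ<; combine)
open import Data.Fin.Properties using (toℕ-fromℕ<; toℕ-injective; toℕ<n; pigeonhole; combine-injective)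
open import Data.Product using (_×_; _,_; Σ; proj₁; proj₂)
open import Data.Sum using (_⊎_; inj₁; inj₂; [_,_]′)
open import Data.Bool using (Bool; true; false)
open import Data.List using (List; takeWhile)
open import Data.List.Membership.Propositional using (_∈_; find; lose)
open import Data.List.Relation.Unary.Any using (Any; here; there; any?)
open import Data.List.Relation.Binary.Sublist.Propositional.Properties using (takeWhile-⊆; Any-resp-⊆)
open import Data.Sign using (Sign) renaming (+ to pos; - to neg)
open import Data.Empty using (⊥; ⊥-elim)
open import Function using (_∘_)
open import Function.Bundles using (_⇔_; mk⇔; Equivalence)
open import Relation.Nullary using (¬_; Dec; yes; no; ¬?)
open import Relation.Nullary.Decidable using (decidable-stable)
open import Relation.Binary.PropositionalEquality using (_≡_; _≢_; refl; sym; trans; cong; cong₂; subst; module ≡-Reasoning)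
open import Algebra.Properties.CommutativeSemigroup +-commutativeSemigroup using (x∙yz≈y∙xz)

least-below : {P : ℕ → Set} → (∀ t → Dec (P t)) → ∀ b →
              (Σ ℕ λ t → t < b × P t × (∀ u → u < t → ¬ P u)) ⊎ (∀ t → t < b → ¬ P t)
least-below P? zero = inj₂ (λ _ ())
least-below P? (suc b) with least-below P? b
... | inj₁ (t , t<b , pt , least) = inj₁ (t , m<n⇒m<1+n t<b , pt , least)
... | inj₂ none with P? b
...   | yes pb = inj₁ (b , n<1+n b , pb , none)
...   | no ¬pb = inj₂ λ t t<1+b → [ none t , (λ { refl → ¬pb }) ]′ (m<1+n⇒m<n∨m≡n t<1+b)

findFrom-first : ∀ (p : ℕ → Bool) f s t → t < f →
                 (∀ u → u < t → p (s + u) ≡ false) → p (s + t) ≡ true → findFrom p f s ≡ s + t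
findFrom-first p (suc f) s zero _ _ hit
  rewrite subst (λ z → p z ≡ true) (+-identityʳ s) hit = sym (+-identityʳ s)
findFrom-first p (suc f) s (suc t) (s≤s t<f) miss hit
  rewrite subst (λ z → p z ≡ false) (+-identityʳ s) (miss 0 (s≤s z≤n)) = begin
    findFrom p f (suc s) ≡⟨ findFrom-first p f (suc s) t t<f miss′ (subst (λ z → p z ≡ true) (+-suc s t) hit) ⟩
    suc s + t            ≡⟨ sym (+-suc s t) ⟩
    s + suc t            ∎
  where
  open ≡-Reasoning
  miss′ : ∀ u → u < t → p (suc s + u) ≡ false
  miss′ u u<t = subst (λ z → p z ≡ false) (+-suc s u) (miss (suc u) (s≤s u<t))

module _ {X : Set} (f : X → X) where

  iterate-suc : ∀ x m → iterate f x (suc m) ≡ f (iterate f x m)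
  iterate-suc x zero    = refl
  iterate-suc x (suc m) = iterate-suc (f x) m

  iterate-+ : ∀ x a b → iterate f x (a + b) ≡ iterate f (iterate f x a) b
  iterate-+ x zero    b = refl
  iterate-+ x (suc a) b = iterate-+ (f x) a b

  iterate-* : ∀ x p q → iterate f x p ≡ x → iterate f x (q * p) ≡ x
  iterate-* x p zero    _  = refl
  iterate-* x p (suc q) fp = begin
    iterate f x (p + q * p)             ≡⟨ iterate-+ x p (q * p) ⟩
    iterate f (iterate f x p) (q * p)   ≡⟨ cong (λ y → iterate f y (q * p)) fp ⟩
    iterate f x (q * p)                 ≡⟨ iterate-* x p q fp ⟩
    x                                   ∎
    where open ≡-Reasoning

  iterate-preserves : (P : X → Set) → (∀ x → P x → P (f x)) → ∀ x m → P x → P (iterate f x m)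
  iterate-preserves P pres x zero    px = px
  iterate-preserves P pres x (suc m) px = iterate-preserves P pres (f x) m (pres x px)

  iterate-reflects : (P Q : X → Set) → (∀ x → Q x → Q (f x)) → (∀ x → Q x → P (f x) → P x) →
                     ∀ x m → Q x → P (iterate f x m) → P x
  iterate-reflects P Q presQ back x zero    qx p = p
  iterate-reflects P Q presQ back x (suc m) qx p =
    back x qx (iterate-reflects P Q presQ back (f x) m (presQ x qx) p)

-- Adding (n - 1) * x is subtracting x modulo n.
complement : ∀ n .{{_ : NonZero n}} x a → x + (a + (n ∸ 1) * x) ≡ a + x * n
complement (suc n′) x a = begin
  x + (a + n′ * x)   ≡⟨ x∙yz≈y∙xz x a (n′ * x) ⟩
  a + (x + n′ * x)   ≡⟨ cong (a +_) (*-comm (suc n′) x) ⟩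
  a + x * suc n′     ∎
  where open ≡-Reasoning

module _ {n : ℕ} .{{_ : NonZero n}} where

  toℕ-shift : ∀ (i : Fin n) m → toℕ (shift i m) ≡ (toℕ i + m) % n
  toℕ-shift i m = toℕ-fromℕ< _

  shift-zero : ∀ (i : Fin n) → shift i 0 ≡ i
  shift-zero i = toℕ-injective (begin
    toℕ (shift i 0)     ≡⟨ toℕ-shift i 0 ⟩
    (toℕ i + 0) % n     ≡⟨ cong (_% n) (+-identityʳ (toℕ i)) ⟩
    toℕ i % n           ≡⟨ m<n⇒m%n≡m (toℕ<n i) ⟩
    toℕ i               ∎)
    where open ≡-Reasoning

  shift-+ : ∀ (i : Fin n) a b → shift (shift i a) b ≡ shift i (a + b)
  shift-+ i a b = toℕ-injective (begin
    toℕ (shift (shift i a) b)             ≡⟨ toℕ-shift (shift i a) b ⟩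
    (toℕ (shift i a) + b) % n             ≡⟨ cong (λ z → (z + b) % n) (toℕ-shift i a) ⟩
    ((toℕ i + a) % n + b) % n             ≡⟨ %-distribˡ-+ ((toℕ i + a) % n) b n ⟩
    ((toℕ i + a) % n % n + b % n) % n     ≡⟨ cong (λ z → (z + b % n) % n) (m%n%n≡m%n (toℕ i + a) n) ⟩
    ((toℕ i + a) % n + b % n) % n         ≡⟨ %-distribˡ-+ (toℕ i + a) b n ⟨
    (toℕ i + a + b) % n                   ≡⟨ cong (_% n) (+-assoc (toℕ i) a b) ⟩
    (toℕ i + (a + b)) % n                 ≡⟨ toℕ-shift i (a + b) ⟨
    toℕ (shift i (a + b))                 ∎)
    where open ≡-Reasoning

  shift-periodic : ∀ (i : Fin n) a c → shift i (a + c * n) ≡ shift i a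
  shift-periodic i a c = toℕ-injective (begin
    toℕ (shift i (a + c * n))   ≡⟨ toℕ-shift i (a + c * n) ⟩
    (toℕ i + (a + c * n)) % n   ≡⟨ cong (_% n) (+-assoc (toℕ i) a (c * n)) ⟨
    (toℕ i + a + c * n) % n     ≡⟨ [m+kn]%n≡m%n (toℕ i + a) c n ⟩
    (toℕ i + a) % n             ≡⟨ toℕ-shift i a ⟨
    toℕ (shift i a)             ∎)
    where open ≡-Reasoning

  shift-+n : ∀ (i : Fin n) a → shift i (a + n) ≡ shift i a
  shift-+n i a = trans (cong (λ z → shift i (a + z)) (sym (*-identityˡ n))) (shift-periodic i a 1)

  shift-n : ∀ (i : Fin n) → shift i n ≡ i
  shift-n i = trans (shift-+n i 0) (shift-zero i)

  shift-undo : ∀ (i : Fin n) t → shift (shift i t) ((n ∸ 1) * t) ≡ i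
  shift-undo i t = begin
    shift (shift i t) ((n ∸ 1) * t)   ≡⟨ shift-+ i t _ ⟩
    shift i (t + (0 + (n ∸ 1) * t))   ≡⟨ cong (shift i) (complement n t 0) ⟩
    shift i (0 + t * n)               ≡⟨ shift-periodic i 0 t ⟩
    shift i 0                         ≡⟨ shift-zero i ⟩
    i                                 ∎
    where open ≡-Reasoning

  shift-surjective : ∀ (j : Fin n) t → Σ (Fin n) λ i → shift i t ≡ j
  shift-surjective j t = shift j ((n ∸ 1) * t) , (begin
    shift (shift j ((n ∸ 1) * t)) t   ≡⟨ shift-+ j _ t ⟩
    shift j ((n ∸ 1) * t + t)         ≡⟨ cong (shift j) (+-comm _ t) ⟩
    shift j (t + (n ∸ 1) * t)         ≡⟨ shift-+ j t _ ⟨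
    shift (shift j t) ((n ∸ 1) * t)   ≡⟨ shift-undo j t ⟩
    j                                 ∎)
    where open ≡-Reasoning

  shift-cancelˡ : ∀ (i j : Fin n) t → shift i t ≡ shift j t → i ≡ j
  shift-cancelˡ i j t eq = begin
    i                                  ≡⟨ shift-undo i t ⟨
    shift (shift i t) ((n ∸ 1) * t)    ≡⟨ cong (λ z → shift z ((n ∸ 1) * t)) eq ⟩
    shift (shift j t) ((n ∸ 1) * t)    ≡⟨ shift-undo j t ⟩
    j                                  ∎
    where open ≡-Reasoning

  shift-difference : ∀ (i j : Fin n) → Σ ℕ λ t → shift i t ≡ j
  shift-difference i j = toℕ j + (n ∸ 1) * toℕ i , toℕ-injective (begin
    toℕ (shift i (toℕ j + (n ∸ 1) * toℕ i))   ≡⟨ toℕ-shift i _ ⟩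
    (toℕ i + (toℕ j + (n ∸ 1) * toℕ i)) % n   ≡⟨ cong (_% n) (complement n (toℕ i) (toℕ j)) ⟩
    (toℕ j + toℕ i * n) % n                   ≡⟨ [m+kn]%n≡m%n (toℕ j) (toℕ i) n ⟩
    toℕ j % n                                 ≡⟨ m<n⇒m%n≡m (toℕ<n j) ⟩
    toℕ j                                     ∎)
    where open ≡-Reasoning

  shift-injectiveʳ : ∀ (i : Fin n) a b → a < n → b < n → shift i a ≡ shift i b → a ≡ b
  shift-injectiveʳ i a b a<n b<n eq = begin
    a                                    ≡⟨ m<n⇒m%n≡m a<n ⟨
    a % n                                ≡⟨ recover a ⟨
    toℕ (shift (shift i a) (back))       ≡⟨ cong (λ z → toℕ (shift z back)) eq ⟩
    toℕ (shift (shift i b) (back))       ≡⟨ recover b ⟩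
    b % n                                ≡⟨ m<n⇒m%n≡m b<n ⟩
    b                                    ∎
    where
    open ≡-Reasoning
    back = (n ∸ 1) * toℕ i
    recover : ∀ c → toℕ (shift (shift i c) back) ≡ c % n
    recover c = begin
      toℕ (shift (shift i c) back)    ≡⟨ cong toℕ (shift-+ i c back) ⟩
      toℕ (shift i (c + back))        ≡⟨ toℕ-shift i (c + back) ⟩
      (toℕ i + (c + back)) % n        ≡⟨ cong (_% n) (complement n (toℕ i) c) ⟩
      (c + toℕ i * n) % n             ≡⟨ [m+kn]%n≡m%n c (toℕ i) n ⟩
      c % n                           ∎

module _ (d : ℕ) .{{_ : NonZero d}} where

  %-cong-+ : ∀ a b c → a % d ≡ b % d → (a + c) % d ≡ (b + c) % d
  %-cong-+ a b c eq = begin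
    (a + c) % d               ≡⟨ %-distribˡ-+ a c d ⟩
    (a % d + c % d) % d       ≡⟨ cong (λ z → (z + c % d) % d) eq ⟩
    (b % d + c % d) % d       ≡⟨ %-distribˡ-+ b c d ⟨
    (b + c) % d               ∎
    where open ≡-Reasoning

  %≡⇒∣∸ : ∀ a b → a % d ≡ b % d → d ∣ b ∸ a
  %≡⇒∣∸ a b eq = divides (b / d ∸ a / d) (begin
    b ∸ a                                       ≡⟨ cong₂ _∸_ (m≡m%n+[m/n]*n b d) (m≡m%n+[m/n]*n a d) ⟩
    (b % d + b / d * d) ∸ (a % d + a / d * d)   ≡⟨ cong (λ z → (b % d + b / d * d) ∸ (z + a / d * d)) eq ⟩
    (b % d + b / d * d) ∸ (b % d + a / d * d)   ≡⟨ [m+n]∸[m+o]≡n∸o (b % d) _ _ ⟩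
    b / d * d ∸ a / d * d                       ≡⟨ *-distribʳ-∸ d (b / d) (a / d) ⟨
    (b / d ∸ a / d) * d                         ∎)
    where open ≡-Reasoning

  ∣∣-∣⇒%≡ : ∀ a b → d ∣ ∣ a - b ∣ → a % d ≡ b % d
  ∣∣-∣⇒%≡ a b d∣ with ≤-total a b
  ... | inj₁ a≤b = sym (trans (cong (_% d) (sym (m+[n∸m]≡n a≤b)))
                     (%-remove-+ʳ a (subst (d ∣_) (m≤n⇒∣m-n∣≡n∸m a≤b) d∣)))
  ... | inj₂ b≤a = trans (cong (_% d) (sym (m+[n∸m]≡n b≤a)))
                     (%-remove-+ʳ b (subst (d ∣_) (m≤n⇒∣n-m∣≡n∸m b≤a) d∣))

  %≡⇒∣∣-∣ : ∀ a b → a % d ≡ b % d → d ∣ ∣ a - b ∣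
  %≡⇒∣∣-∣ a b eq with ≤-total a b
  ... | inj₁ a≤b = subst (d ∣_) (sym (m≤n⇒∣m-n∣≡n∸m a≤b)) (%≡⇒∣∸ a b eq)
  ... | inj₂ b≤a = subst (d ∣_) (sym (m≤n⇒∣n-m∣≡n∸m b≤a)) (%≡⇒∣∸ b a (sym eq))

-- Translations by multiples of K modulo N: by Bézout, starting from x they
-- reach exactly the residues of N congruent to x modulo gcd N K.
module Translation (N K : ℕ) .{{_ : NonZero N}} where

  instance
    gcd-nonZero : NonZero (gcd N K)
    gcd-nonZero = ≢-nonZero (gcd[m,n]≢0 N K (inj₁ (≢-nonZero⁻¹ N)))

  private
    d = gcd N K

  same-class-difference : ∀ x y → x % d ≡ y % d → Σ ℕ λ t → d ∣ t × (x + t) % N ≡ y % N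
  same-class-difference x y eq = t , d∣t , (begin
      (x + t) % N        ≡⟨ cong (_% N) sum ⟩
      (y + x * N) % N    ≡⟨ [m+kn]%n≡m%n y x N ⟩
      y % N              ∎)
    where
    open ≡-Reasoning
    t = y + (N ∸ 1) * x
    sum : x + t ≡ y + x * N
    sum = complement N x y
    same : x % d ≡ (x + t) % d
    same = begin
      x % d              ≡⟨ eq ⟩
      y % d              ≡⟨ %-remove-+ʳ y (∣n⇒∣m*n x (gcd[m,n]∣m N K)) ⟨
      (y + x * N) % d    ≡⟨ cong (_% d) sum ⟨
      (x + t) % d        ∎
    d∣t : d ∣ t
    d∣t = subst (d ∣_) (m+n∸m≡n x t) (%≡⇒∣∸ d x (x + t) same)

  translate-reaches : ∀ x y → x % d ≡ y % d → Σ ℕ λ m → (x + m * K) % N ≡ y % N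
  translate-reaches x y eq with Bézout.identity (gcd-GCD N K)
  ... | Bézout.-+ a b bez with same-class-difference x y eq
  ...   | t , divides q t≡qd , reach = q * b , (begin
    (x + q * b * K) % N          ≡⟨ cong (λ z → (x + z) % N) multiple ⟩
    (x + (t + q * a * N)) % N    ≡⟨ cong (_% N) (+-assoc x t (q * a * N)) ⟨
    (x + t + q * a * N) % N      ≡⟨ [m+kn]%n≡m%n (x + t) (q * a) N ⟩
    (x + t) % N                  ≡⟨ reach ⟩
    y % N                        ∎)
    where
    open ≡-Reasoning
    multiple : q * b * K ≡ t + q * a * N
    multiple = begin
      q * b * K          ≡⟨ *-assoc q b K ⟩
      q * (b * K)        ≡⟨ cong (q *_) bez ⟨
      q * (d + a * N)    ≡⟨ *-distribˡ-+ q d (a * N) ⟩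
      q * d + q * (a * N) ≡⟨ cong₂ _+_ (sym t≡qd) (sym (*-assoc q a N)) ⟩
      t + q * a * N      ∎
  translate-reaches x y eq | Bézout.+- a b bez with same-class-difference y x (sym eq)
  ...   | t , divides q t≡qd , reach = q * b , (begin
    (x + q * b * K) % N          ≡⟨ %-cong-+ N x (y + t) (q * b * K) (sym reach) ⟩
    (y + t + q * b * K) % N      ≡⟨ cong (_% N) (+-assoc y t (q * b * K)) ⟩
    (y + (t + q * b * K)) % N    ≡⟨ cong (λ z → (y + z) % N) multiple ⟩
    (y + q * a * N) % N          ≡⟨ [m+kn]%n≡m%n y (q * a) N ⟩
    y % N                        ∎)
    where
    open ≡-Reasoning
    multiple : t + q * b * K ≡ q * a * N
    multiple = begin
      t + q * b * K        ≡⟨ cong₂ _+_ t≡qd (*-assoc q b K) ⟩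
      q * d + q * (b * K)  ≡⟨ *-distribˡ-+ q d (b * K) ⟨
      q * (d + b * K)      ≡⟨ cong (q *_) bez ⟩
      q * (a * N)          ≡⟨ *-assoc q a N ⟨
      q * a * N            ∎

odd⇒coprime : ∀ m → ¬ 2 ∣ suc (suc m) → gcd (suc (suc m)) m ≡ 1
odd⇒coprime m odd = divisor-of-2 (gcd k m) (gcd[m,n]∣m k m)
  (∣m+n∣m⇒∣n (subst (gcd k m ∣_) (+-comm 2 m) (gcd[m,n]∣m k m)) (gcd[m,n]∣n k m))
  where
  k = suc (suc m)
  divisor-of-2 : ∀ d → d ∣ k → d ∣ 2 → d ≡ 1
  divisor-of-2 zero              _   0∣2 with () ← 0∣⇒≡0 0∣2
  divisor-of-2 (suc zero)        _   _   = refl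
  divisor-of-2 (suc (suc zero))  2∣k _   = ⊥-elim (odd 2∣k)
  divisor-of-2 (suc (suc (suc _))) _ d∣2 with s≤s (s≤s ()) ← ∣⇒≤ d∣2

module Orbits {n : ℕ} .{{_ : NonZero n}} (A : Array n) (R C : Fin n → Sign) where

  move : Cell n → Cell n
  move = S A R C

  orbit : Cell n → ℕ → Cell n
  orbit = iterate move

  private
    before : Cell n → List (Cell n) → List (Cell n)
    before c = takeWhile (λ x → ¬? (x ≟c c))

  iterates-orbit : ∀ m c y → y ∈ iterates A R C m c → Σ ℕ λ t → y ≡ orbit c t
  iterates-orbit (suc m) c y (here y≡c)  = 0 , y≡c
  iterates-orbit (suc m) c y (there y∈) with iterates-orbit m (move c) y y∈
  ... | t , y≡ = suc t , y≡

  ∈L⇒orbit : ∀ c y → y ∈ L A R C c → Σ ℕ λ t → y ≡ orbit c t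
  ∈L⇒orbit c y (here y≡c) = 0 , y≡c
  ∈L⇒orbit c y (there y∈) with iterates-orbit (n * n) (move c) y (Any-resp-⊆ (takeWhile-⊆ _ _) y∈)
  ... | t , y≡ = suc t , y≡

  prefix∈before : ∀ c N c′ r → r < N → (∀ u → u ≤ r → orbit c′ u ≢ c) →
                  orbit c′ r ∈ before c (iterates A R C N c′)
  prefix∈before c (suc N) c′ r r<N avoid with c′ ≟c c
  ... | yes c′≡c = ⊥-elim (avoid 0 z≤n c′≡c)
  prefix∈before c (suc N) c′ zero    _         avoid | no _ = here refl
  prefix∈before c (suc N) c′ (suc r) (s≤s r<N) avoid | no _ =
    there (prefix∈before c N (move c′) r r<N (λ u u≤r → avoid (suc u) (s≤s u≤r)))

  -- When S maps filled cells injectively to filled cells, every filled cell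
  -- lies on a cycle of length at most n², so L c is the whole orbit of c.
  module InjectiveMove (move-filled : ∀ c → F A c → F A (move c))
                       (move-injective : ∀ a b → F A a → F A b → move a ≡ move b → a ≡ b) where

    orbit-filled : ∀ c m → F A c → F A (orbit c m)
    orbit-filled c m = iterate-preserves move (F A) move-filled c m

    repeat⇒return : ∀ c i j → F A c → orbit c i ≡ orbit c (i + j) → orbit c j ≡ c
    repeat⇒return c zero    j _  eq = sym eq
    repeat⇒return c (suc i) j fc eq = repeat⇒return c i j fc
      (move-injective _ _ (orbit-filled c i fc) (orbit-filled c (i + j) fc) (begin
        move (orbit c i)        ≡⟨ iterate-suc move c i ⟨
        orbit c (suc i)         ≡⟨ eq ⟩
        orbit c (suc i + j)     ≡⟨ iterate-suc move c (i + j) ⟩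
        move (orbit c (i + j))  ∎))
      where open ≡-Reasoning

    code : Cell n → Fin (n * n)
    code (a , b) = combine a b

    code-injective : ∀ {x y} → code x ≡ code y → x ≡ y
    code-injective {a , b} {a′ , b′} eq with refl , refl ← combine-injective a b a′ b′ eq = refl

    period : ∀ c → F A c → Σ ℕ λ q → 1 ≤ q × q ≤ n * n × orbit c q ≡ c
    period c fc with pigeonhole (n<1+n (n * n)) (λ t → code (orbit c (toℕ t)))
    ... | i , j , i<j , same = toℕ j ∸ toℕ i , m<n⇒0<n∸m i<j ,
          ≤-trans (m∸n≤m (toℕ j) (toℕ i)) (≤-pred (toℕ<n j)) ,
          repeat⇒return c (toℕ i) (toℕ j ∸ toℕ i) fc
            (trans (code-injective same) (cong (orbit c) (sym (m+[n∸m]≡n (<⇒≤ i<j)))))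

    minimal-period : ∀ c → F A c → Σ ℕ λ t → suc t ≤ n * n × orbit c (suc t) ≡ c ×
                                            (∀ u → u < t → orbit c (suc u) ≢ c)
    minimal-period c fc with period c fc
    ... | suc q , _ , q≤ , returns with least-below (λ t → orbit c (suc t) ≟c c) (suc q)
    ...   | inj₁ (t , t<q , ret , least) = t , ≤-trans t<q q≤ , ret , least
    ...   | inj₂ none = ⊥-elim (none q (n<1+n q) returns)

    orbit∈L : ∀ c → F A c → ∀ m → orbit c m ∈ L A R C c
    orbit∈L c fc m with minimal-period c fc
    ... | t , p≤ , returns , least = subst (_∈ L A R C c) (sym reduce) (within (m % suc t) (m%n<n m (suc t)))
      where
      p = suc t
      reduce : orbit c m ≡ orbit c (m % p)
      reduce = begin
        orbit c m                            ≡⟨ cong (orbit c) (trans (m≡m%n+[m/n]*n m p) (+-comm (m % p) _)) ⟩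
        orbit c (m / p * p + m % p)          ≡⟨ iterate-+ move c (m / p * p) (m % p) ⟩
        orbit (orbit c (m / p * p)) (m % p)  ≡⟨ cong (λ x → orbit x (m % p)) (iterate-* move c p (m / p) returns) ⟩
        orbit c (m % p)                      ∎
        where open ≡-Reasoning
      within : ∀ r → r < p → orbit c r ∈ L A R C c
      within zero    _       = here refl
      within (suc r) (s≤s r<t) = there (prefix∈before c (n * n) (move c) r (<-trans r<t p≤)
                                    (λ u u≤r → least u (≤-<-trans u≤r r<t)))

-- Subtracting 2 modulo k₂ + 2 (on offsets δ < k₂ + 2).
down₂ : ℕ → ℕ → ℕ
down₂ k₂ zero          = k₂
down₂ k₂ (suc zero)    = suc k₂
down₂ k₂ (suc (suc δ)) = δ

down₂-bound : ∀ k₂ δ → δ < suc (suc k₂) → down₂ k₂ δ < suc (suc k₂)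
down₂-bound k₂ zero          _  = m<n⇒m<1+n (n<1+n k₂)
down₂-bound k₂ (suc zero)    _  = n<1+n (suc k₂)
down₂-bound k₂ (suc (suc δ)) lt = <-trans (m<n⇒m<1+n (n<1+n δ)) lt

down₂-injective : ∀ k₂ a b → a < suc (suc k₂) → b < suc (suc k₂) → down₂ k₂ a ≡ down₂ k₂ b → a ≡ b
down₂-injective k₂ zero          zero          _  _  _  = refl
down₂-injective k₂ zero          (suc zero)    _  _  eq = ⊥-elim (1+n≢n (sym eq))
down₂-injective k₂ zero          (suc (suc b)) _  lt eq = ⊥-elim (<-irrefl (sym eq) (≤-pred (≤-pred lt)))
down₂-injective k₂ (suc zero)    zero          _  _  eq = ⊥-elim (1+n≢n eq)
down₂-injective k₂ (suc zero)    (suc zero)    _  _  _  = refl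
down₂-injective k₂ (suc zero)    (suc (suc b)) _  lt eq = ⊥-elim (<-irrefl (sym eq) (m<n⇒m<1+n (≤-pred (≤-pred lt))))
down₂-injective k₂ (suc (suc a)) zero          lt _  eq = ⊥-elim (<-irrefl eq (≤-pred (≤-pred lt)))
down₂-injective k₂ (suc (suc a)) (suc zero)    lt _  eq = ⊥-elim (<-irrefl eq (m<n⇒m<1+n (≤-pred (≤-pred lt))))
down₂-injective k₂ (suc (suc a)) (suc (suc b)) _  _  eq = cong (suc ∘ suc) eq

down₂-translation : ∀ k₂ δ → δ < suc (suc k₂) → down₂ k₂ δ ≡ (δ + k₂) % suc (suc k₂)
down₂-translation k₂ zero          _  = sym (m<n⇒m%n≡m (m<n⇒m<1+n (n<1+n k₂)))
down₂-translation k₂ (suc zero)    _  = sym (m<n⇒m%n≡m (n<1+n (suc k₂)))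
down₂-translation k₂ (suc (suc δ)) lt = sym (begin
  (suc (suc δ) + k₂) % suc (suc k₂)   ≡⟨ cong (_% suc (suc k₂)) (sym (trans (+-suc δ (suc k₂)) (cong suc (+-suc δ k₂)))) ⟩
  (δ + suc (suc k₂)) % suc (suc k₂)   ≡⟨ [m+n]%n≡m%n δ (suc (suc k₂)) ⟩
  δ % suc (suc k₂)                    ≡⟨ m<n⇒m%n≡m (<-trans (m<n⇒m<1+n (n<1+n δ)) lt) ⟩
  δ                                   ∎)
  where open ≡-Reasoning

-- For odd k = k₂ + 2, the translation by k₂ ≡ -2 generates ℤ/k, so a set of
-- offsets containing 0 and closed under down₂ contains every offset below k.
down₂-cycle : ∀ k₂ → ¬ 2 ∣ suc (suc k₂) → (P : ℕ → Set) → P 0 →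
              (∀ δ → δ < suc (suc k₂) → P δ → P (down₂ k₂ δ)) → ∀ δ → δ < suc (suc k₂) → P δ
down₂-cycle k₂ odd P P0 closed δ δ<k with translate-reaches 0 δ same-class
  where
  open Translation (suc (suc k₂)) k₂
  same-class : 0 % gcd (suc (suc k₂)) k₂ ≡ δ % gcd (suc (suc k₂)) k₂
  same-class = ∣∣-∣⇒%≡ (gcd (suc (suc k₂)) k₂) 0 δ (subst (_∣ ∣ 0 - δ ∣) (sym (odd⇒coprime k₂ odd)) (1∣ _))
... | m , reaches = subst P (trans reaches (m<n⇒m%n≡m δ<k)) (multiples m)
  where
  k = suc (suc k₂)
  multiples : ∀ m → P ((0 + m * k₂) % k)
  multiples zero    = P0
  multiples (suc m) = subst P (begin
      down₂ k₂ ((m * k₂) % k)        ≡⟨ down₂-translation k₂ _ (m%n<n (m * k₂) k) ⟩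
      ((m * k₂) % k + k₂) % k        ≡⟨ %-cong-+ k ((m * k₂) % k) (m * k₂) k₂ (m%n%n≡m%n (m * k₂) k) ⟩
      (m * k₂ + k₂) % k              ≡⟨ cong (_% k) (+-comm (m * k₂) k₂) ⟩
      (k₂ + m * k₂) % k              ∎)
    (closed _ (m%n<n (m * k₂) k) (multiples m))
    where open ≡-Reasoning

-- The standard cyclically k-diagonal array with k = k₂ + 2 and n = k + g + 1.
-- A cell is addressed by its column j and its offset δ: cellOf j δ = (j + δ, j)
-- lies on the diagonal D_{δ+1}, so it is filled exactly when δ < k.
-- The size n is kept as a variable with an equation n≡, so that the lists L below are
-- syntactically those of the statement and are never unfolded when compared.
module StandardArray {n : ℕ} .{{_ : NonZero n}} (k₂ g : ℕ) (n≡ : n ≡ suc (suc (suc k₂) + g))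
                     (A : Array n) (SF : StandardForm (suc (suc k₂)) A) where

  k : ℕ
  k = suc (suc k₂)

  k<n : k < n
  k<n = subst (k <_) (sym n≡) (s≤s (m≤m+n k g))

  0<n : 0 < n
  0<n = <-trans (s≤s z≤n) k<n

  gap<n : suc g < n
  gap<n = subst (suc g <_) (sym n≡) (s≤s (s≤s (m≤n+m g (suc k₂))))

  cellOf : Fin n → ℕ → Cell n
  cellOf j δ = shift j δ , j

  cellOf-injective : ∀ {i j a b} → a < n → b < n → cellOf i a ≡ cellOf j b → i ≡ j × a ≡ b
  cellOf-injective {i} a<n b<n eq with cong proj₂ eq
  ... | refl = refl , shift-injectiveʳ i _ _ a<n b<n (cong proj₁ eq)

  filled-at : ∀ {c j δ} → c ≡ cellOf j δ → δ < k → A c ≡ true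
  filled-at {δ = δ} refl δ<k = Equivalence.from (SF _) (suc δ , s≤s z≤n , δ<k , refl)

  offset-of : ∀ c → A c ≡ true → Σ ℕ λ δ → δ < k × c ≡ cellOf (col c) δ
  offset-of c@(_ , j) filled with Equivalence.to (SF c) filled
  ... | suc δ , _ , δ<k , on-diagonal = δ , δ<k , cong (_, j) on-diagonal

  empty-at : ∀ {c j δ} → c ≡ cellOf j δ → k ≤ δ → δ < n → A c ≡ false
  empty-at {c} {j} {δ} c≡ k≤δ δ<n with A c in filled
  ... | false = refl
  ... | true with offset-of c filled
  ...   | δ′ , δ′<k , c≡′ with cellOf-injective δ<n (<-trans δ′<k k<n)
                                 (trans (sym c≡) (subst (λ z → c ≡ cellOf z δ′) (cong proj₂ c≡) c≡′))
  ...     | _ , refl = ⊥-elim (<⇒≱ δ′<k k≤δ)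

  -- K = k - 1 is the largest filled offset; jump = n - k + 1 is the distance along
  -- a row from a diagonal cell to the next filled cell.
  K jump : ℕ
  K    = suc k₂
  jump = suc (suc g)

  K+jump≡n : K + jump ≡ n
  K+jump≡n = trans (cong suc (trans (+-suc k₂ (suc g)) (cong suc (+-suc k₂ g)))) (sym n≡)

  diagonal-cell : ∀ j → (j , j) ≡ cellOf j 0
  diagonal-cell j = cong (_, j) (sym (shift-zero j))

  gap-offset : ∀ {u} → u < suc g → Σ ℕ λ r → u + r ≡ g × k + r < n
  gap-offset {u} u<sg with m≤n⇒∃[o]m+o≡n (≤-pred u<sg)
  ... | r , u+r≡g = r , u+r≡g , subst (k + r <_) (sym n≡) (s≤s (+-monoʳ-≤ k (subst (r ≤_) u+r≡g (m≤n+m r u))))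

  column-cell : ∀ j δ t → (shift (shift j δ) t , j) ≡ cellOf j (δ + t)
  column-cell j δ t = cong (_, j) (shift-+ j δ t)

  row-cell : ∀ j u v → u + v ≡ n → (shift j 0 , shift j u) ≡ cellOf (shift j u) v
  row-cell j u v u+v≡n = cong (_, shift j u) (begin
    shift j 0                ≡⟨ shift-zero j ⟩
    j                        ≡⟨ shift-n j ⟨
    shift j n                ≡⟨ cong (shift j) u+v≡n ⟨
    shift j (u + v)          ≡⟨ shift-+ j u v ⟨
    shift (shift j u) v      ∎)
    where open ≡-Reasoning

  wrap-cell : ∀ j a → a ≡ n → (shift j a , j) ≡ cellOf j 0
  wrap-cell j a a≡n = cong (_, j) (trans (cong (shift j) a≡n) (trans (shift-n j) (sym (shift-zero j))))

  -- Row successor: from offset 0 the g + 1 empty diagonals are skipped.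
  sr-diagonal : ∀ j → sr A (cellOf j 0) ≡ cellOf (shift j jump) (suc k₂)
  sr-diagonal j = trans (cong (λ u → shift j 0 , shift j u) found) (row-cell j jump K jump+K≡n)
    where
    p = λ u → A (shift j 0 , shift j u)
    jump+K≡n : jump + K ≡ n
    jump+K≡n = trans (+-comm jump K) K+jump≡n
    miss : ∀ u → u < suc g → p (suc u) ≡ false
    miss u u<sg with gap-offset u<sg
    ... | r , u+r≡g , k+r<n = empty-at (row-cell j (suc u) (k + r)
                                (trans (cong suc (trans (x∙yz≈y∙xz u k r) (cong (k +_) u+r≡g))) (sym n≡))) (m≤m+n k r) k+r<n
    found : findFrom p n 1 ≡ jump
    found = findFrom-first p n 1 (suc g) gap<n miss
              (filled-at (row-cell j jump K jump+K≡n) (n<1+n K))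

  sr-offset : ∀ j δ → suc δ < k → sr A (cellOf j (suc δ)) ≡ cellOf (shift j 1) δ
  sr-offset j δ lt = trans (cong (λ u → shift j (suc δ) , shift j u) found) next
    where
    next : (shift j (suc δ) , shift j 1) ≡ cellOf (shift j 1) δ
    next = cong (_, shift j 1) (sym (shift-+ j 1 δ))
    p = λ u → A (shift j (suc δ) , shift j u)
    found : findFrom p n 1 ≡ 1 + 0
    found = findFrom-first p n 1 0 0<n (λ _ ()) (filled-at next (≤-pred (m<n⇒m<1+n lt)))

  sc-up : ∀ j δ → suc δ < k → sc A (cellOf j δ) ≡ cellOf j (suc δ)
  sc-up j δ lt = trans (cong (λ t → shift (shift j δ) t , j) found) below
    where
    below : (shift (shift j δ) 1 , j) ≡ cellOf j (suc δ)
    below = trans (column-cell j δ 1) (cong (cellOf j) (+-comm δ 1))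
    p = λ t → A (shift (shift j δ) t , j)
    found : findFrom p n 1 ≡ 1 + 0
    found = findFrom-first p n 1 0 0<n (λ _ ()) (filled-at below lt)

  sc-wrap : ∀ j → sc A (cellOf j (suc k₂)) ≡ cellOf j 0
  sc-wrap j = trans (cong (λ t → shift (shift j (suc k₂)) t , j) found) bottom
    where
    p = λ t → A (shift (shift j (suc k₂)) t , j)
    bottom : (shift (shift j (suc k₂)) jump , j) ≡ cellOf j 0
    bottom = trans (column-cell j (suc k₂) jump) (wrap-cell j _ K+jump≡n)
    miss : ∀ u → u < suc g → p (suc u) ≡ false
    miss u u<sg with gap-offset u<sg
    ... | r , u+r≡g , _ = empty-at (trans (column-cell j (suc k₂) (suc u)) (cong (cellOf j) (+-suc (suc k₂) u)))
                            (m≤m+n k u) (subst (k + u <_) (sym n≡) (s≤s (+-monoʳ-≤ k (subst (u ≤_) u+r≡g (m≤m+n u r)))))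
    found : findFrom p n 1 ≡ jump
    found = findFrom-first p n 1 (suc g) gap<n miss (filled-at bottom (s≤s z≤n))

  sc⁻¹-down : ∀ j δ → suc δ < k → sc⁻¹ A (cellOf j (suc δ)) ≡ cellOf j δ
  sc⁻¹-down j δ lt = trans (cong (λ t → shift (shift j (suc δ)) (n ∸ t) , j) found) above
    where
    above : (shift (shift j (suc δ)) (n ∸ 1) , j) ≡ cellOf j δ
    above = trans (column-cell j (suc δ) (n ∸ 1)) (cong (_, j) (trans (cong (shift j) δ+n≡) (shift-+n j δ)))
      where
      δ+n≡ : suc δ + (n ∸ 1) ≡ δ + n
      δ+n≡ = trans (cong (λ z → suc δ + (z ∸ 1)) n≡) (trans (sym (+-suc δ (k + g))) (cong (δ +_) (sym n≡)))
    p = λ t → A (shift (shift j (suc δ)) (n ∸ t) , j)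
    found : findFrom p n 1 ≡ 1 + 0
    found = findFrom-first p n 1 0 0<n (λ _ ()) (filled-at above (≤-pred (m<n⇒m<1+n lt)))

  sc⁻¹-wrap : ∀ j → sc⁻¹ A (cellOf j 0) ≡ cellOf j (suc k₂)
  sc⁻¹-wrap j = trans (cong (λ t → shift (shift j 0) (n ∸ t) , j) found) top
    where
    p = λ t → A (shift (shift j 0) (n ∸ t) , j)
    top : (shift (shift j 0) (n ∸ jump) , j) ≡ cellOf j (suc k₂)
    top = trans (column-cell j 0 (n ∸ jump)) (cong (cellOf j) (trans (cong (_∸ jump) n≡) (m+n∸n≡m (suc k₂) g)))
    miss : ∀ u → u < suc g → p (suc u) ≡ false
    miss u u<sg with gap-offset u<sg
    ... | r , u+r≡g , k+r<n = empty-at (trans (column-cell j 0 (n ∸ suc u)) (cong (cellOf j) n-u≡))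
                                (m≤m+n k r) k+r<n
      where
      n-u≡ : n ∸ suc u ≡ k + r
      n-u≡ = begin
        n ∸ suc u          ≡⟨ cong (_∸ suc u) n≡ ⟩
        k + g ∸ u          ≡⟨ cong (λ z → k + z ∸ u) u+r≡g ⟨
        k + (u + r) ∸ u    ≡⟨ cong (_∸ u) (x∙yz≈y∙xz k u r) ⟩
        u + (k + r) ∸ u    ≡⟨ m+n∸m≡n u (k + r) ⟩
        k + r              ∎
        where open ≡-Reasoning
    found : findFrom p n 1 ≡ jump
    found = findFrom-first p n 1 (suc g) gap<n miss (filled-at top (n<1+n (suc k₂)))

  next-offset : Sign → ℕ → ℕ
  next-offset pos δ = δ
  next-offset neg δ = down₂ k₂ δ

  next-offset-bound : ∀ s δ → δ < k → next-offset s δ < k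
  next-offset-bound pos δ δ<k = δ<k
  next-offset-bound neg δ δ<k = down₂-bound k₂ δ δ<k

  next-offset-injective : ∀ s a b → a < k → b < k → next-offset s a ≡ next-offset s b → a ≡ b
  next-offset-injective pos a b _   _   eq = eq
  next-offset-injective neg a b a<k b<k eq = down₂-injective k₂ a b a<k b<k eq

  -- The vertical half of a move: after the row step lands at offset δ - 1 (mod k),
  -- the column step in direction s lands at offset `next-offset s δ`.
  column-from-top : ∀ j s → colStep A s (cellOf j (suc k₂)) ≡ cellOf j (next-offset s 0)
  column-from-top j pos = sc-wrap j
  column-from-top j neg = sc⁻¹-down j k₂ (n<1+n (suc k₂))

  column-from-below : ∀ j s δ → suc δ < k → colStep A s (cellOf j δ) ≡ cellOf j (next-offset s (suc δ))
  column-from-below j pos δ        lt = sc-up j δ lt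
  column-from-below j neg zero     _  = sc⁻¹-wrap j
  column-from-below j neg (suc δ)  lt = sc⁻¹-down j δ (<-trans (n<1+n (suc δ)) lt)

  column-step : ℕ → ℕ
  column-step zero    = jump
  column-step (suc _) = 1

  module Moves (C : Fin n → Sign) where

    open Orbits A (λ _ → pos) C public

    target : Fin n → ℕ → Fin n
    target j δ = shift j (column-step δ)

    move-cellOf : ∀ j δ → δ < k → move (cellOf j δ) ≡ cellOf (target j δ) (next-offset (C (target j δ)) δ)
    move-cellOf j zero    _  = trans (cong (λ c → colStep A (C (col c)) c) (sr-diagonal j))
                                     (column-from-top (shift j jump) (C (shift j jump)))
    move-cellOf j (suc δ) lt = trans (cong (λ c → colStep A (C (col c)) c) (sr-offset j δ lt))
                                     (column-from-below (shift j 1) (C (shift j 1)) δ lt)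

    move-filled : ∀ c → F A c → F A (move c)
    move-filled c fc with offset-of c fc
    ... | δ , δ<k , c≡ = filled-at (trans (cong move c≡) (move-cellOf (col c) δ δ<k)) (next-offset-bound (C (target (col c) δ)) δ δ<k)

    move-injective : ∀ a b → F A a → F A b → move a ≡ move b → a ≡ b
    move-injective (_ , ja) (_ , jb) fa fb eq with offset-of _ fa | offset-of _ fb
    ... | δa , δa<k , refl | δb , δb<k , refl
      with cellOf-injective (<-trans (next-offset-bound (C (target ja δa)) δa δa<k) k<n)
                          (<-trans (next-offset-bound (C (target jb δb)) δb δb<k) k<n)
             (trans (sym (move-cellOf ja δa δa<k)) (trans eq (move-cellOf jb δb δb<k)))
    ...   | Ja≡Jb , offsets≡
      with refl ← next-offset-injective (C (target jb δb)) δa δb δa<k δb<k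
                    (trans (cong (λ J → next-offset (C J) δa) (sym Ja≡Jb)) offsets≡)
      with refl ← shift-cancelˡ ja jb (column-step δa) Ja≡Jb = refl

    open InjectiveMove move-filled move-injective public

    -- The starting cell (1,1).  It is written out rather than named, so that it
    -- matches `IsSolution` syntactically and `L` is never unfolded during checking.
    origin-filled : F A (origin , origin)
    origin-filled = filled-at (diagonal-cell origin) (s≤s z≤n)

    open Translation n K using (gcd-nonZero; translate-reaches)

    d : ℕ
    d = gcd n K

    d∣jump : d ∣ jump
    d∣jump = ∣m+n∣m⇒∣n (subst (d ∣_) (sym K+jump≡n) (gcd[m,n]∣m n K)) (gcd[m,n]∣n n K)

    class-shift : ∀ j {t} → d ∣ t → toℕ (shift j t) % d ≡ toℕ j % d
    class-shift j {t} d∣t = begin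
      toℕ (shift j t) % d       ≡⟨ cong (_% d) (toℕ-shift j t) ⟩
      (toℕ j + t) % n % d       ≡⟨ m∣n⇒o%n%m≡o%m d n (toℕ j + t) (gcd[m,n]∣m n K) ⟩
      (toℕ j + t) % d           ≡⟨ %-remove-+ʳ (toℕ j) d∣t ⟩
      toℕ j % d                 ∎
      where open ≡-Reasoning

    -- A set of positive columns that is invariant under the jump: the diagonal cells
    -- in those columns are closed under the move and its inverse, and the orbit of
    -- such a cell stays at offset 0.  So if L(1,1) contains one of them, it misses
    -- the filled cells at offset 1.
    module PositiveColumns (P : Fin n → Set) (jump-invariant : ∀ j → P (shift j jump) ⇔ P j)
                           (positive : ∀ j → P j → C j ≡ pos) where

      OnDiagonal : Cell n → Set
      OnDiagonal c = Σ (Fin n) λ j → P j × c ≡ cellOf j 0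

      onDiagonal-forward : ∀ c → OnDiagonal c → OnDiagonal (move c)
      onDiagonal-forward _ (j , pj , refl) = target j 0 , pJ , trans (move-cellOf j 0 (s≤s z≤n))
                                               (cong (λ s → cellOf (target j 0) (next-offset s 0)) (positive _ pJ))
        where
        pJ : P (target j 0)
        pJ = Equivalence.from (jump-invariant j) pj

      onDiagonal-backward : ∀ c → F A c → OnDiagonal (move c) → OnDiagonal c
      onDiagonal-backward (_ , j) fc (J , pJ , moved) with offset-of _ fc
      ... | δ , δ<k , refl
        with target≡J , offset≡0 ← cellOf-injective (<-trans (next-offset-bound (C (target j δ)) δ δ<k) k<n) 0<n
                                     (trans (sym (move-cellOf j δ δ<k)) moved)
        with pT ← subst P (sym target≡J) pJ
        with refl ← trans (cong (λ s → next-offset s δ) (sym (positive (target j δ) pT))) offset≡0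
        = j , Equivalence.to (jump-invariant j) pT , refl

      not-solution : ∀ r → P r → IsSolution A (λ _ → pos) C → ⊥
      not-solution r pr sol = offset-1≢0 (proj₂ (cellOf-injective (<-trans (s≤s (s≤s z≤n)) k<n) 0<n
                                                    (proj₂ (proj₂ c₁-on-diagonal))))
        where
        offset-1≢0 : 1 ≢ 0
        offset-1≢0 ()
        origin-on-diagonal : OnDiagonal (origin , origin)
        origin-on-diagonal = iterate-reflects move OnDiagonal (F A) move-filled onDiagonal-backward (origin , origin)
                          (proj₁ r-visited) origin-filled (subst OnDiagonal (proj₂ r-visited) (r , pr , diagonal-cell r))
          where r-visited = ∈L⇒orbit (origin , origin) (r , r) (sol (r , r) (filled-at (diagonal-cell r) (s≤s z≤n)))
        c₁ : Cell n
        c₁ = cellOf origin 1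
        c₁-on-diagonal : OnDiagonal c₁
        c₁-on-diagonal = subst OnDiagonal (sym (proj₂ c₁-visited))
                           (iterate-preserves move OnDiagonal onDiagonal-forward (origin , origin) (proj₁ c₁-visited) origin-on-diagonal)
          where c₁-visited = ∈L⇒orbit (origin , origin) c₁ (sol c₁ (filled-at {c₁} {origin} {1} refl (s≤s (s≤s z≤n))))

    Reached : Cell n → Set
    Reached c = Σ ℕ λ m → c ≡ orbit (origin , origin) m

    reached-move : ∀ {c} → Reached c → Reached (move c)
    reached-move (m , refl) = suc m , sym (iterate-suc move (origin , origin) m)

    module Signs (E : List (Fin n)) (signs : ∀ j → (C j ≡ neg) ⇔ (j ∈ E)) where

      outside-E-positive : ∀ j → ¬ j ∈ E → C j ≡ pos
      outside-E-positive j j∉E with C j in cj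
      ... | pos = refl
      ... | neg = ⊥-elim (j∉E (Equivalence.to (signs j) cj))

      -- A solution leaves no class modulo d without a negative column: otherwise the
      -- columns of that class are positive and invariant under the jump.
      solution⇒covers : IsSolution A (λ _ → pos) C → CoversResidues d E
      solution⇒covers sol x = decidable-stable (any? (λ e → d ∣? ∣ toℕ e - x ∣) E) λ missing →
        PositiveColumns.not-solution InClass invariant (positive missing) r r-in sol
        where
        InClass : Fin n → Set
        InClass j = toℕ j % d ≡ x % d
        invariant : ∀ j → InClass (shift j jump) ⇔ InClass j
        invariant j = mk⇔ (trans (sym (class-shift j d∣jump))) (trans (class-shift j d∣jump))
        positive : ¬ Any (λ e → d ∣ ∣ toℕ e - x ∣) E → ∀ j → InClass j → C j ≡ pos
        positive missing j cls = outside-E-positive j (λ j∈E → missing (lose j∈E (%≡⇒∣∣-∣ d (toℕ j) x cls)))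
        r : Fin n
        r = fromℕ< (m%n<n x n)
        r-in : InClass r
        r-in = trans (cong (_% d) (toℕ-fromℕ< (m%n<n x n))) (m∣n⇒o%n%m≡o%m d n x (gcd[m,n]∣m n K))

      solution⇒diagonal : IsSolution A (λ _ → pos) C → ∀ e → e ∈ E → (e , e) ∈ L A (λ _ → pos) C (origin , origin)
      solution⇒diagonal sol e _ = sol (e , e) (filled-at (diagonal-cell e) (s≤s z≤n))

      -- Conversely, when E covers all classes and the orbit of (1,1) visits the cells
      -- (e, e), e ∈ E, it visits first every diagonal cell, then (for odd k) every
      -- offset, hence every filled cell.
      module Converse (covers : CoversResidues d E) (visited : ∀ e → e ∈ E → Reached (e , e)) where

        OffsetReached : ℕ → Set
        OffsetReached δ = ∀ j → Reached (cellOf j δ)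

        E-reached : ∀ e → e ∈ E → Reached (cellOf e 0)
        E-reached e e∈E = subst Reached (diagonal-cell e) (visited e e∈E)

        -- The move takes (x + K, x + K) to (x, x) when column x is positive, so (x, x)
        -- is reached as soon as one of x, x + K, …, x + mK is negative.
        diagonal-chain : ∀ m x → shift x (m * K) ∈ E → Reached (cellOf x 0)
        diagonal-chain zero    x ∈E = E-reached x (subst (_∈ E) (shift-zero x) ∈E)
        diagonal-chain (suc m) x ∈E with C x in cx
        ... | neg = E-reached x (Equivalence.to (signs x) cx)
        ... | pos = subst Reached arrive
                      (reached-move (diagonal-chain m (shift x K) (subst (_∈ E) (sym (shift-+ x K (m * K))) ∈E)))
          where
          back : target (shift x K) 0 ≡ x
          back = trans (shift-+ x K jump) (trans (cong (shift x) K+jump≡n) (shift-n x))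
          arrive : move (cellOf (shift x K) 0) ≡ cellOf x 0
          arrive = trans (move-cellOf (shift x K) 0 (s≤s z≤n))
                     (trans (cong (λ J → cellOf J (next-offset (C J) 0)) back) (cong (λ s → cellOf x (next-offset s 0)) cx))

        -- Every column x has a multiple x + mK landing in E (Bézout), so all diagonal cells are reached.
        diagonal-reached : OffsetReached 0
        diagonal-reached x
          with e , e∈E , d∣ ← find (covers (toℕ x))
          with m , reaches ← translate-reaches (toℕ x) (toℕ e) (sym (∣∣-∣⇒%≡ d (toℕ e) (toℕ x) d∣))
          = diagonal-chain m x (subst (_∈ E) (sym (toℕ-injective
              (trans (toℕ-shift x (m * K)) (trans reaches (m<n⇒m%n≡m (toℕ<n e)))))) e∈E)

        -- Some column is negative, as E is nonempty.
        e₀ : Fin n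
        e₀ = proj₁ (find (covers 0))

        e₀-negative : C e₀ ≡ neg
        e₀-negative = Equivalence.from (signs e₀) (proj₁ (proj₂ (find (covers 0))))

        -- The orbit enters offset δ′ = δ − 2 (mod k) ≠ 0 through the negative columns
        -- and then follows positive columns one step to the right at a time.
        offset-spread : ∀ δ δ′ → δ < k → suc δ′ < k → down₂ k₂ δ ≡ suc δ′ →
                        OffsetReached δ → OffsetReached (suc δ′)
        offset-spread δ δ′ δ<k δ′<k down≡ reached j with t , e₀+t≡j ← shift-difference e₀ j
          = subst (λ J → Reached (cellOf J (suc δ′))) e₀+t≡j (along t)
          where
          entering : ∀ J → C J ≡ neg → Reached (cellOf J (suc δ′))
          entering J cJ with i , i+s≡J ← shift-surjective J (column-step δ)
            = subst Reached arrive (reached-move (reached i))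
            where
            arrive : move (cellOf i δ) ≡ cellOf J (suc δ′)
            arrive = trans (move-cellOf i δ δ<k) (trans (cong (λ J′ → cellOf J′ (next-offset (C J′) δ)) i+s≡J)
                       (trans (cong (λ s → cellOf J (next-offset s δ)) cJ) (cong (cellOf J) down≡)))
          along : ∀ t → Reached (cellOf (shift e₀ t) (suc δ′))
          along zero = subst (λ J → Reached (cellOf J (suc δ′))) (sym (shift-zero e₀)) (entering e₀ e₀-negative)
          along (suc t) with C (shift e₀ (suc t)) in cJ
          ... | neg = entering _ cJ
          ... | pos = subst Reached arrive (reached-move (along t))
            where
            next : target (shift e₀ t) (suc δ′) ≡ shift e₀ (suc t)
            next = trans (shift-+ e₀ t 1) (cong (shift e₀) (+-comm t 1))
            arrive : move (cellOf (shift e₀ t) (suc δ′)) ≡ cellOf (shift e₀ (suc t)) (suc δ′)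
            arrive = trans (move-cellOf (shift e₀ t) (suc δ′) δ′<k) (trans (cong (λ J → cellOf J (next-offset (C J) (suc δ′))) next)
                       (cong (λ s → cellOf (shift e₀ (suc t)) (next-offset s (suc δ′))) cJ))

        offset-down : ∀ δ → δ < k → OffsetReached δ → OffsetReached (down₂ k₂ δ)
        offset-down δ δ<k reached with down₂ k₂ δ in down≡
        ... | zero    = diagonal-reached
        ... | suc δ′  = offset-spread δ δ′ δ<k (subst (_< k) down≡ (down₂-bound k₂ δ δ<k)) down≡ reached

        all-reached : ¬ 2 ∣ k → ∀ c → F A c → Reached c
        all-reached odd c fc = subst Reached (sym (proj₂ (proj₂ (offset-of c fc))))
          (down₂-cycle k₂ odd OffsetReached diagonal-reached offset-down _ (proj₁ (proj₂ (offset-of c fc))) (col c))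

      covers⇒solution : ¬ 2 ∣ k → CoversResidues d E → (∀ e → e ∈ E → (e , e) ∈ L A (λ _ → pos) C (origin , origin)) →
                        IsSolution A (λ _ → pos) C
      covers⇒solution odd covers diagonal c fc = subst (_∈ L A (λ _ → pos) C (origin , origin)) (sym (proj₂ reached))
                                                   (orbit∈L (origin , origin) origin-filled (proj₁ reached))
        where
        reached : Reached c
        reached = Converse.all-reached covers (λ e e∈E → ∈L⇒orbit (origin , origin) (e , e) (diagonal e e∈E)) odd c fc

-- Lemma 4.7.  Write k = k₂ + 2 and n = k + g + 1; the forward implication holds
-- for every k ≥ 2, oddness of k is used only for the converse.
lemma4p7 : (n k : ℕ) .{{_ : NonZero n}} → 3 ≤ k → ¬ (2 ∣ k) → k < n →
           (A : Array n) → StandardForm k A →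
           (C : Fin n → Sign) (E : List (Fin n)) → (∀ j → (C j ≡ neg) ⇔ (j ∈ E)) →
           IsSolution A (λ _ → pos) C
             ⇔ (CoversResidues (gcd n (k ∸ 1)) E × (∀ e → e ∈ E → (e , e) ∈ L A (λ _ → pos) C (origin , origin)))
lemma4p7 n (suc (suc k₂)) (s≤s (s≤s _)) odd k<n A SF C E signs with g , n≡ ← m≤n⇒∃[o]m+o≡n k<n =
  mk⇔ (λ sol → solution⇒covers sol , solution⇒diagonal sol)
      (λ (covers , diagonal) → covers⇒solution odd covers diagonal)
  where
  open StandardArray k₂ g (sym n≡) A SF
  open Moves C
  open Signs E signs
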